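{- Let $n,a,b$ be positive integers with $a+b<n$ and $b>\frac n2$. For every integer $i$ with $0\le i\le 2b-n+1$, $$|\mathcal F_i(n,a,b)|=\binom{n-1-i}{b-i}\binom{b-i}{a}+\binom{n-b+a-1}{a-1}\left(\binom{n}{b-a}-\binom{n-i}{b-a-i}\right).$$ Moreover, put $i_0:=b-1-\frac{(n-b)(n-b-1)}{a}$. If $i_0<0$, the largest value of $|\mathcal F_i(n,a,b)|$ over $0\le i\le 2b-n+1$ occurs only for $i=0$. If $i_0\ge0$ is an integer, the largest value occurs for $i\in\{i_0,i_0+1\}$. If $i_0\ge0$ is not an integer, the largest value occurs only for $i=\lceil i_0\rceil$.
   Context: $[n]=\{1,\dots,n\}$, $[0]=\emptyset$. The vertices of $\Gamma(n,\{a,b\})$ (for $a<b$) are the pairs $(A,B)$ with $A\subseteq B\subseteq[n]$, $|A|=a$, $|B|=b$. For positive integers $n,a,b$ with $a<\frac n2<b$, $a+b<n$ and an integer $0\le i\le 2b-n+1$, $\mathcal F_i(n,a,b)$ is the set of such pairs $(A,B)$ satisfying at least one of (I) $[i]\subseteq B\subseteq[n-1]$, (II) $\min A\le i$ and $[\min A]\subseteq B$. -}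

module Defs where

open import Data.Nat using (ℕ; zero; suc; _+_; _*_; _∸_; _≤_; _<_; _≤?_; _<?_)
open import Data.Fin using (Fin; toℕ)
open import Data.Fin.Properties using (any?; all?)
open import Data.Fin.Subset using (Subset; _∈_; _⊆_; ∣_∣; inside; outside)
open import Data.Fin.Subset.Properties using (_∈?_; _⊆?_)
open import Data.List using (List; []; _∷_; map; _++_; filter; length; cartesianProduct)
open import Data.Vec using (Vec)
open import Data.Product using (Σ; _×_; _,_; proj₁; proj₂)
open import Data.Sum using (_⊎_)
open import Relation.Binary.PropositionalEquality using (_≡_)
open import Relation.Nullary using (Dec)
open import Relation.Nullary.Decidable using (_×-dec_; _⊎-dec_; _→-dec_)
import Data.Nat.Properties as ℕP

-- Ground set [n] = {1,…,n} is represented by Fin n: the element k ∈ [n]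
-- corresponds to the Fin n element with toℕ = k - 1.
-- Subsets of [n] are `Subset n` (Vec Bool n) from the standard library.

allSubsets : (n : ℕ) → List (Subset n)
allSubsets zero    = Data.Vec.[] ∷ []
allSubsets (suc n) = map (outside Data.Vec.∷_) (allSubsets n)
                  ++ map (inside Data.Vec.∷_) (allSubsets n)

IsVertex : {n : ℕ} → (a b : ℕ) → Subset n → Subset n → Set
IsVertex a b A B = A ⊆ B × ∣ A ∣ ≡ a × ∣ B ∣ ≡ b

IsMin : {n : ℕ} → Fin n → Subset n → Set
IsMin m A = m ∈ A × ((y : Fin _) → y ∈ A → toℕ m ≤ toℕ y)

-- (I)  [i] ⊆ B ⊆ [n-1]
-- [i] = {1,…,i} = elements with 0-based index < i;
-- B ⊆ [n-1] means every element of B has 0-based index < n - 1.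
CondI : (n i : ℕ) → Subset n → Set
CondI n i B = ((x : Fin n) → toℕ x < i → x ∈ B)
            × ((x : Fin n) → x ∈ B → toℕ x < n ∸ 1)

-- (II)  min A ≤ i  and  [min A] ⊆ B.
-- With m the 0-based minimum, the 1-based minimum is toℕ m + 1, so
-- "min A ≤ i" is toℕ m < i, and [min A] = elements with 0-based index ≤ toℕ m.
CondII : (n i : ℕ) → Subset n → Subset n → Set
CondII n i A B = Σ (Fin n) λ m → IsMin m A × toℕ m < i
                 × ((y : Fin n) → toℕ y ≤ toℕ m → y ∈ B)

InF : (n a b i : ℕ) → Subset n → Subset n → Set
InF n a b i A B = IsVertex a b A B × (CondI n i B ⊎ CondII n i A B)

isMin? : {n : ℕ} → (m : Fin n) → (A : Subset n) → Dec (IsMin m A)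
isMin? m A = (m ∈? A) ×-dec all? (λ y → (y ∈? A) →-dec (toℕ m ≤? toℕ y))

condI? : (n i : ℕ) → (B : Subset n) → Dec (CondI n i B)
condI? n i B = all? (λ x → (toℕ x <? i) →-dec (x ∈? B))
         ×-dec all? (λ x → (x ∈? B) →-dec (toℕ x <? n ∸ 1))

condII? : (n i : ℕ) → (A B : Subset n) → Dec (CondII n i A B)
condII? n i A B = any? (λ m → isMin? m A ×-dec (toℕ m <? i)
                    ×-dec all? (λ y → (toℕ y ≤? toℕ m) →-dec (y ∈? B)))

inF? : (n a b i : ℕ) → (A B : Subset n) → Dec (InF n a b i A B)
inF? n a b i A B = ((A ⊆? B) ×-dec (∣ A ∣ ℕP.≟ a) ×-dec (∣ B ∣ ℕP.≟ b))
                   ×-dec (condI? n i B ⊎-dec condII? n i A B)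

cardF : (n a b i : ℕ) → ℕ
cardF n a b i = length (filter (λ p → inF? n a b i (proj₁ p) (proj₂ p))
                               (cartesianProduct (allSubsets n) (allSubsets n)))

-- Sort the pairs (A , B) by the element 1. If 1 ∈ A, condition (II) holds and the rest is an arbitrary vertex
-- on {2,…,n}; if 1 ∈ B ∖ A, the pair lies in 𝓕ᵢ₊₁(n,a,b) iff its shift lies in 𝓕ᵢ(n-1,a,b-1); if 1 ∉ B, it lies
-- in no 𝓕ᵢ₊₁. Hence |𝓕₀(n,a,b)| = C(n-1,b) C(b,a) and
--   |𝓕ᵢ₊₁(n,a,b)| = |𝓕ᵢ(n-1,a,b-1)| + C(n-1,b-1) C(b-1,a-1).
-- Unrolling the recursion, each vertex count C(m,b') C(b',a-1) equals C(n-b+a-1,a-1) C(m,b'-a+1), and these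
-- telescope by Pascal's rule into the closed formula. Consecutive terms differ by w - v with
-- w / v = a (b-1-i) / ((n-b)(n-b-1)), so |𝓕ᵢ| increases while a (b-1-i) > (n-b)(n-b-1) and decreases
-- afterwards; the turning point is i₀ = b-1-(n-b)(n-b-1)/a.

module Submission where

open import Defs
open import Data.Bool using (Bool; true; false; T)
open import Data.Fin using (Fin; toℕ) renaming (zero to fzero; suc to fsuc)
open import Data.Fin.Subset using (Subset; _∈_; inside; outside)
open import Data.Fin.Subset.Properties using (drop-there; drop-∷-⊆; out⊆; in⊆in)
open import Data.List using (List; []; _∷_; _++_; map; filter; length; cartesianProduct)
open import Data.List.Properties using (map-++; map-∘; map-cong; filter-++; length-++)
open import Data.Nat using (ℕ; zero; suc; _+_; _*_; _∸_; _≤_; _<_; z≤n; s≤s; _!; NonZero; >-nonZero; >-nonZero⁻¹)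
open import Data.Nat.Combinatorics using (_C_; nCk+nC[k+1]≡[n+1]C[k+1]; nCk≡n!/k![n-k]!; k![n∸k]!∣n!)
open import Data.Nat.DivMod using (_/_; m%n<n; m≡m%n+[m/n]*n; m/n*n≤m; m/n*n≡m)
open import Data.Nat.Divisibility using (_∣_; divides)
open import Data.Nat.ListAction using (sum)
open import Data.Nat.ListAction.Properties using (sum-++)
open import Data.Nat.Properties
open import Data.Nat.Tactic.RingSolver using (solve-∀)
open import Data.Product using (_×_; _,_; proj₁; proj₂)
open import Data.Product.Function.NonDependent.Propositional using (_×-⇔_)
open import Data.Sum using (inj₁; inj₂)
open import Data.Sum.Function.Propositional using (_⊎-⇔_)
open import Data.Unit using (tt)
open import Data.Vec using ([]; _∷_; here; there)
open import Function using (_∘_; case_of_; _⇔_; mk⇔; Equivalence)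
open import Function.Construct.Composition using (_⇔-∘_)
open import Level using (0ℓ)
open import Relation.Binary.Definitions using (tri<; tri≈; tri>)
open import Relation.Binary.PropositionalEquality using (_≡_; _≢_; refl; sym; trans; cong; cong₂; subst; subst₂; module ≡-Reasoning)
open import Relation.Nullary using (¬_; Dec; does; contradiction)
open import Relation.Nullary.Decidable using (dec-true; dec-false)
open import Relation.Unary using (Pred; Decidable)

indicator : Bool → ℕ
indicator true  = 1
indicator false = 0

sumOver : {A : Set} → List A → (A → ℕ) → ℕ
sumOver xs f = sum (map f xs)

module _ {A : Set} where

  sumOver-++ : (xs ys : List A) (f : A → ℕ) → sumOver (xs ++ ys) f ≡ sumOver xs f + sumOver ys f
  sumOver-++ xs ys f = trans (cong sum (map-++ f xs ys)) (sum-++ (map f xs) (map f ys))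

  sumOver-map : {B : Set} (g : A → B) (xs : List A) (f : B → ℕ) → sumOver (map g xs) f ≡ sumOver xs (f ∘ g)
  sumOver-map g xs f = cong sum (sym (map-∘ xs))

  sumOver-cong : (xs : List A) {f g : A → ℕ} → (∀ x → f x ≡ g x) → sumOver xs f ≡ sumOver xs g
  sumOver-cong xs f≗g = cong sum (map-cong f≗g xs)

  sumOver-+ : (xs : List A) (f g : A → ℕ) → sumOver xs (λ x → f x + g x) ≡ sumOver xs f + sumOver xs g
  sumOver-+ []       f g = refl
  sumOver-+ (x ∷ xs) f g = trans (cong (f x + g x +_) (sumOver-+ xs f g)) (interchange (f x) (g x) _ _)
    where
    interchange : ∀ p q r s → (p + q) + (r + s) ≡ (p + r) + (q + s)
    interchange = solve-∀

  sumOver-zero : (xs : List A) → sumOver xs (λ _ → 0) ≡ 0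
  sumOver-zero []       = refl
  sumOver-zero (x ∷ xs) = sumOver-zero xs

length-filter≡sumOver : {A : Set} {P : Pred A 0ℓ} (P? : Decidable P) (xs : List A) →
  length (filter P? xs) ≡ sumOver xs (indicator ∘ does ∘ P?)
length-filter≡sumOver P? []       = refl
length-filter≡sumOver P? (x ∷ xs) with does (P? x)
... | true  = cong suc (length-filter≡sumOver P? xs)
... | false = length-filter≡sumOver P? xs

length-filter-cartesianProduct : {A B : Set} {P : Pred (A × B) 0ℓ} (P? : Decidable P) (xs : List A) (ys : List B) →
  length (filter P? (cartesianProduct xs ys))
    ≡ sumOver xs λ x → sumOver ys λ y → indicator (does (P? (x , y)))
length-filter-cartesianProduct P? []       ys = refl
length-filter-cartesianProduct P? (x ∷ xs) ys = begin
  length (filter P? (map (x ,_) ys ++ cartesianProduct xs ys))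
    ≡⟨ cong length (filter-++ P? (map (x ,_) ys) _) ⟩
  length (filter P? (map (x ,_) ys) ++ filter P? (cartesianProduct xs ys))
    ≡⟨ length-++ (filter P? (map (x ,_) ys)) ⟩
  length (filter P? (map (x ,_) ys)) + length (filter P? (cartesianProduct xs ys))
    ≡⟨ cong₂ _+_ (trans (length-filter≡sumOver P? (map (x ,_) ys)) (sumOver-map (x ,_) ys _))
                 (length-filter-cartesianProduct P? xs ys) ⟩
  _ ∎
  where open ≡-Reasoning

-- Opaque, so that n and p can be recovered from pairCount n p by unification.
opaque
  pairCount : (n : ℕ) → (Subset n → Subset n → Bool) → ℕ
  pairCount n p = sumOver (allSubsets n) λ A → sumOver (allSubsets n) λ B → indicator (p A B)

sumOver-allSubsets-suc : ∀ {n} (f : Subset (suc n) → ℕ) →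
  sumOver (allSubsets (suc n)) f ≡ sumOver (allSubsets n) (f ∘ (outside ∷_)) + sumOver (allSubsets n) (f ∘ (inside ∷_))
sumOver-allSubsets-suc {n} f = trans (sumOver-++ (map (outside ∷_) (allSubsets n)) _ f)
  (cong₂ _+_ (sumOver-map _ (allSubsets n) f) (sumOver-map _ (allSubsets n) f))

opaque
  unfolding pairCount

  cardF≡pairCount-inF? : ∀ n a b i → cardF n a b i ≡ pairCount n (λ A B → does (inF? n a b i A B))
  cardF≡pairCount-inF? n a b i =
    length-filter-cartesianProduct (λ p → inF? n a b i (proj₁ p) (proj₂ p)) (allSubsets n) (allSubsets n)

  pairCount-zero : (p : Subset 0 → Subset 0 → Bool) → pairCount 0 p ≡ indicator (p [] [])
  pairCount-zero p = trans (+-identityʳ _) (+-identityʳ _)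

  pairCount-cong : ∀ {n} {p q : Subset n → Subset n → Bool} → (∀ A B → p A B ≡ q A B) → pairCount n p ≡ pairCount n q
  pairCount-cong {n} p≗q = sumOver-cong (allSubsets n) λ A → sumOver-cong (allSubsets n) λ B → cong indicator (p≗q A B)

  pairCount-false : ∀ {n} → pairCount n (λ _ _ → false) ≡ 0
  pairCount-false {n} = trans (sumOver-cong (allSubsets n) λ _ → sumOver-zero (allSubsets n)) (sumOver-zero (allSubsets n))

  pairCount-suc : ∀ {n} (p : Subset (suc n) → Subset (suc n) → Bool) → pairCount (suc n) p ≡
    (pairCount n (λ A B → p (outside ∷ A) (outside ∷ B)) + pairCount n (λ A B → p (outside ∷ A) (inside ∷ B)))
    + (pairCount n (λ A B → p (inside ∷ A) (outside ∷ B)) + pairCount n (λ A B → p (inside ∷ A) (inside ∷ B)))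
  pairCount-suc {n} p = trans (sumOver-allSubsets-suc {n} _) (cong₂ _+_ (splitOnB outside) (splitOnB inside))
    where
    splitOnB : ∀ x → sumOver (allSubsets n) (λ A → sumOver (allSubsets (suc n)) λ B → indicator (p (x ∷ A) B))
      ≡ pairCount n (λ A B → p (x ∷ A) (outside ∷ B)) + pairCount n (λ A B → p (x ∷ A) (inside ∷ B))
    splitOnB x = trans (sumOver-cong (allSubsets n) λ A → sumOver-allSubsets-suc {n} _) (sumOver-+ (allSubsets n) _ _)

-- Membership decided by the first element

isVertexᵇ : (n : ℕ) → ℕ → ℕ → Subset n → Subset n → Bool
isVertexᵇ zero    zero    zero    []            []            = true
isVertexᵇ zero    zero    (suc b) []            []            = false
isVertexᵇ zero    (suc a) b       []            []            = false
isVertexᵇ (suc n) a       b       (outside ∷ A) (outside ∷ B) = isVertexᵇ n a b A B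
isVertexᵇ (suc n) a       zero    (outside ∷ A) (inside ∷ B)  = false
isVertexᵇ (suc n) a       (suc b) (outside ∷ A) (inside ∷ B)  = isVertexᵇ n a b A B
isVertexᵇ (suc n) a       b       (inside ∷ A)  (outside ∷ B) = false
isVertexᵇ (suc n) zero    b       (inside ∷ A)  (inside ∷ B)  = false
isVertexᵇ (suc n) (suc a) zero    (inside ∷ A)  (inside ∷ B)  = false
isVertexᵇ (suc n) (suc a) (suc b) (inside ∷ A)  (inside ∷ B)  = isVertexᵇ n a b A B

inF₀ᵇ : (n : ℕ) → ℕ → ℕ → Subset n → Subset n → Bool
inF₀ᵇ zero          a       b       A             B             = isVertexᵇ zero a b A B
inF₀ᵇ (suc n)       a       b       (outside ∷ A) (outside ∷ B) = inF₀ᵇ n a b A B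
inF₀ᵇ (suc zero)    a       b       (outside ∷ A) (inside ∷ B)  = false
inF₀ᵇ (suc (suc n)) a       zero    (outside ∷ A) (inside ∷ B)  = false
inF₀ᵇ (suc (suc n)) a       (suc b) (outside ∷ A) (inside ∷ B)  = inF₀ᵇ (suc n) a b A B
inF₀ᵇ (suc n)       a       b       (inside ∷ A)  (outside ∷ B) = false
inF₀ᵇ (suc zero)    a       b       (inside ∷ A)  (inside ∷ B)  = false
inF₀ᵇ (suc (suc n)) zero    b       (inside ∷ A)  (inside ∷ B)  = false
inF₀ᵇ (suc (suc n)) (suc a) zero    (inside ∷ A)  (inside ∷ B)  = false
inF₀ᵇ (suc (suc n)) (suc a) (suc b) (inside ∷ A)  (inside ∷ B)  = inF₀ᵇ (suc n) a b A B

inFᵇ : (n a b i : ℕ) → Subset n → Subset n → Bool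
inFᵇ n             a       b       zero    A             B             = inF₀ᵇ n a b A B
inFᵇ zero          a       b       (suc i) []            []            = isVertexᵇ zero a b [] []
inFᵇ (suc n)       a       b       (suc i) (outside ∷ A) (outside ∷ B) = false
inFᵇ (suc zero)    a       b       (suc i) (outside ∷ A) (inside ∷ B)  = false
inFᵇ (suc (suc n)) a       zero    (suc i) (outside ∷ A) (inside ∷ B)  = false
inFᵇ (suc (suc n)) a       (suc b) (suc i) (outside ∷ A) (inside ∷ B)  = inFᵇ (suc n) a b i A B
inFᵇ (suc n)       a       b       (suc i) (inside ∷ A)  (outside ∷ B) = false
inFᵇ (suc n)       zero    b       (suc i) (inside ∷ A)  (inside ∷ B)  = false
inFᵇ (suc n)       (suc a) zero    (suc i) (inside ∷ A)  (inside ∷ B)  = false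
inFᵇ (suc n)       (suc a) (suc b) (suc i) (inside ∷ A)  (inside ∷ B)  = isVertexᵇ n a b A B

⇔-false : {P : Set} → ¬ P → P ⇔ T false
⇔-false ¬p = mk⇔ (λ p → contradiction p ¬p) λ ()

does≡ : {P : Set} (P? : Dec P) {b : Bool} → P ⇔ T b → does P? ≡ b
does≡ P? {true}  P⇔T = dec-true P? (Equivalence.from P⇔T tt)
does≡ P? {false} P⇔T = dec-false P? (Equivalence.to P⇔T)

module _ {n a b : ℕ} {A B : Subset n} where

  isVertex-out-out : IsVertex a b (outside ∷ A) (outside ∷ B) ⇔ IsVertex a b A B
  isVertex-out-out = mk⇔ (λ (⊆ , ∣A∣ , ∣B∣) → drop-∷-⊆ ⊆ , ∣A∣ , ∣B∣)
                         (λ (⊆ , ∣A∣ , ∣B∣) → out⊆ ⊆ , ∣A∣ , ∣B∣)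

  isVertex-out-in : IsVertex a (suc b) (outside ∷ A) (inside ∷ B) ⇔ IsVertex a b A B
  isVertex-out-in = mk⇔ (λ (⊆ , ∣A∣ , ∣B∣) → drop-∷-⊆ ⊆ , ∣A∣ , suc-injective ∣B∣)
                        (λ (⊆ , ∣A∣ , ∣B∣) → out⊆ ⊆ , ∣A∣ , cong suc ∣B∣)

  isVertex-in-in : IsVertex (suc a) (suc b) (inside ∷ A) (inside ∷ B) ⇔ IsVertex a b A B
  isVertex-in-in = mk⇔ (λ (⊆ , ∣A∣ , ∣B∣) → drop-∷-⊆ ⊆ , suc-injective ∣A∣ , suc-injective ∣B∣)
                       (λ (⊆ , ∣A∣ , ∣B∣) → in⊆in ⊆ , cong suc ∣A∣ , cong suc ∣B∣)

  ¬isVertex-in-out : ¬ IsVertex a b (inside ∷ A) (outside ∷ B)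
  ¬isVertex-in-out (⊆ , _) with ⊆ here
  ... | ()

¬isVertex-b≡0 : ∀ {n a x} {A B : Subset n} → ¬ IsVertex a 0 (x ∷ A) (inside ∷ B)
¬isVertex-b≡0 (_ , _ , ())

¬isVertex-a≡0 : ∀ {n b} {A B : Subset n} → ¬ IsVertex 0 b (inside ∷ A) (inside ∷ B)
¬isVertex-a≡0 (_ , () , _)

isVertex⇔ : ∀ n a b (A B : Subset n) → IsVertex a b A B ⇔ T (isVertexᵇ n a b A B)
isVertex⇔ zero    zero    zero    []            []            = mk⇔ (λ _ → tt) λ _ → (λ ()) , refl , refl
isVertex⇔ zero    zero    (suc b) []            []            = ⇔-false λ ()
isVertex⇔ zero    (suc a) b       []            []            = ⇔-false λ ()
isVertex⇔ (suc n) a       b       (outside ∷ A) (outside ∷ B) = isVertex⇔ n a b A B ⇔-∘ isVertex-out-out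
isVertex⇔ (suc n) a       zero    (outside ∷ A) (inside ∷ B)  = ⇔-false ¬isVertex-b≡0
isVertex⇔ (suc n) a       (suc b) (outside ∷ A) (inside ∷ B)  = isVertex⇔ n a b A B ⇔-∘ isVertex-out-in
isVertex⇔ (suc n) a       b       (inside ∷ A)  (outside ∷ B) = ⇔-false ¬isVertex-in-out
isVertex⇔ (suc n) zero    b       (inside ∷ A)  (inside ∷ B)  = ⇔-false ¬isVertex-a≡0
isVertex⇔ (suc n) (suc a) zero    (inside ∷ A)  (inside ∷ B)  = ⇔-false ¬isVertex-b≡0
isVertex⇔ (suc n) (suc a) (suc b) (inside ∷ A)  (inside ∷ B)  = isVertex⇔ n a b A B ⇔-∘ isVertex-in-in

AvoidsLast : (n : ℕ) → Subset n → Set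
AvoidsLast n B = (x : Fin n) → x ∈ B → toℕ x < n ∸ 1

ContainsPrefix : {n : ℕ} → ℕ → Subset n → Set
ContainsPrefix i B = (x : Fin _) → toℕ x < i → x ∈ B

suc<⇒<∸1 : ∀ {t n} → suc t < n → t < n ∸ 1
suc<⇒<∸1 {n = suc n} (s≤s t<n) = t<n

<∸1⇒suc< : ∀ {t n} → t < n ∸ 1 → suc t < n
<∸1⇒suc< {n = suc n} t<n = s≤s t<n

module _ {n : ℕ} {B : Subset n} where

  avoidsLast-out : AvoidsLast (suc n) (outside ∷ B) ⇔ AvoidsLast n B
  avoidsLast-out = mk⇔ (λ avoids x x∈B → suc<⇒<∸1 (avoids (fsuc x) (there x∈B)))
                       λ { avoids fzero () ; avoids (fsuc x) (there x∈B) → <∸1⇒suc< (avoids x x∈B) }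

  containsPrefix-in : ∀ {i} → ContainsPrefix (suc i) (inside ∷ B) ⇔ ContainsPrefix i B
  containsPrefix-in = mk⇔ (λ contains x x<i → drop-there (contains (fsuc x) (s≤s x<i)))
                          λ { contains fzero _ → here ; contains (fsuc x) (s≤s x<i) → there (contains x x<i) }

  ¬containsPrefix-out : ∀ {i} → ¬ ContainsPrefix (suc i) (outside ∷ B)
  ¬containsPrefix-out contains with contains fzero (s≤s z≤n)
  ... | ()

avoidsLast-in : ∀ {n} {B : Subset (suc n)} → AvoidsLast (suc (suc n)) (inside ∷ B) ⇔ AvoidsLast (suc n) B
avoidsLast-in = mk⇔ (λ avoids x x∈B → suc<⇒<∸1 (avoids (fsuc x) (there x∈B)))
                    λ { avoids fzero _ → s≤s z≤n ; avoids (fsuc x) (there x∈B) → <∸1⇒suc< (avoids x x∈B) }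

¬avoidsLast-in-[] : ¬ AvoidsLast 1 (inside ∷ [])
¬avoidsLast-in-[] avoids with avoids fzero here
... | ()

module _ {n : ℕ} {A B : Subset n} where

  condII-out-in : ∀ {i} → CondII (suc n) (suc i) (outside ∷ A) (inside ∷ B) ⇔ CondII n i A B
  condII-out-in = mk⇔
    (λ { (fzero , (() , _) , _)
       ; (fsuc m , (m∈A , m≤A) , m<i , B⊇[m]) →
           m , (drop-there m∈A , λ y y∈A → ≤-pred (m≤A (fsuc y) (there y∈A))) , ≤-pred m<i
             , λ y y≤m → drop-there (B⊇[m] (fsuc y) (s≤s y≤m)) })
    λ (m , (m∈A , m≤A) , m<i , B⊇[m]) →
      fsuc m , (there m∈A , λ { fzero () ; (fsuc y) (there y∈A) → s≤s (m≤A y y∈A) }) , s≤s m<i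
        , λ { fzero _ → here ; (fsuc y) (s≤s y≤m) → there (B⊇[m] y y≤m) }

  condII-in-in : ∀ {i} → CondII (suc n) (suc i) (inside ∷ A) (inside ∷ B)
  condII-in-in = fzero , (here , λ _ _ → z≤n) , s≤s z≤n , λ { fzero _ → here ; (fsuc y) () }

  ¬condII-out : ∀ {i x} → ¬ CondII (suc n) i (x ∷ A) (outside ∷ B)
  ¬condII-out (_ , _ , _ , B⊇[m]) with B⊇[m] fzero z≤n
  ... | ()

¬condII-0 : ∀ {n} {A B : Subset n} → ¬ CondII n 0 A B
¬condII-0 (_ , _ , () , _)

inF₀⇔ : ∀ n a b (A B : Subset n) → (IsVertex a b A B × AvoidsLast n B) ⇔ T (inF₀ᵇ n a b A B)
inF₀⇔ zero          a       b       []            []            = isVertex⇔ zero a b [] [] ⇔-∘ mk⇔ proj₁ (λ v → v , λ ())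
inF₀⇔ (suc n)       a       b       (outside ∷ A) (outside ∷ B) = inF₀⇔ n a b A B ⇔-∘ (isVertex-out-out ×-⇔ avoidsLast-out)
inF₀⇔ (suc zero)    a       b       (outside ∷ A) (inside ∷ []) = ⇔-false (¬avoidsLast-in-[] ∘ proj₂)
inF₀⇔ (suc (suc n)) a       zero    (outside ∷ A) (inside ∷ B)  = ⇔-false (¬isVertex-b≡0 ∘ proj₁)
inF₀⇔ (suc (suc n)) a       (suc b) (outside ∷ A) (inside ∷ B)  = inF₀⇔ (suc n) a b A B ⇔-∘ (isVertex-out-in ×-⇔ avoidsLast-in)
inF₀⇔ (suc n)       a       b       (inside ∷ A)  (outside ∷ B) = ⇔-false (¬isVertex-in-out ∘ proj₁)
inF₀⇔ (suc zero)    a       b       (inside ∷ A)  (inside ∷ []) = ⇔-false (¬avoidsLast-in-[] ∘ proj₂)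
inF₀⇔ (suc (suc n)) zero    b       (inside ∷ A)  (inside ∷ B)  = ⇔-false (¬isVertex-a≡0 ∘ proj₁)
inF₀⇔ (suc (suc n)) (suc a) zero    (inside ∷ A)  (inside ∷ B)  = ⇔-false (¬isVertex-b≡0 ∘ proj₁)
inF₀⇔ (suc (suc n)) (suc a) (suc b) (inside ∷ A)  (inside ∷ B)  = inF₀⇔ (suc n) a b A B ⇔-∘ (isVertex-in-in ×-⇔ avoidsLast-in)

inF⇔ : ∀ n a b i (A B : Subset n) → InF n a b i A B ⇔ T (inFᵇ n a b i A B)
inF⇔ n a b zero A B = inF₀⇔ n a b A B ⇔-∘ mk⇔
  (λ { (v , inj₁ (_ , avoids)) → v , avoids ; (_ , inj₂ c) → contradiction c ¬condII-0 })
  (λ (v , avoids) → v , inj₁ ((λ _ ()) , avoids))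
inF⇔ zero a b (suc i) [] [] = isVertex⇔ zero a b [] [] ⇔-∘ mk⇔ proj₁ (λ v → v , inj₁ ((λ ()) , λ ()))
inF⇔ (suc n) a b (suc i) (outside ∷ A) (outside ∷ B) =
  ⇔-false λ { (_ , inj₁ (contains , _)) → ¬containsPrefix-out contains ; (_ , inj₂ c) → ¬condII-out c }
inF⇔ (suc zero) a b (suc i) (outside ∷ A) (inside ∷ []) =
  ⇔-false λ { (_ , inj₁ (_ , avoids)) → ¬avoidsLast-in-[] avoids ; (_ , inj₂ c) → case Equivalence.to condII-out-in c of λ () }
inF⇔ (suc (suc n)) a zero (suc i) (outside ∷ A) (inside ∷ B) = ⇔-false (¬isVertex-b≡0 ∘ proj₁)
inF⇔ (suc (suc n)) a (suc b) (suc i) (outside ∷ A) (inside ∷ B) =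
  inF⇔ (suc n) a b i A B ⇔-∘ (isVertex-out-in ×-⇔ ((containsPrefix-in ×-⇔ avoidsLast-in) ⊎-⇔ condII-out-in))
inF⇔ (suc n) a b (suc i) (inside ∷ A) (outside ∷ B) = ⇔-false (¬isVertex-in-out ∘ proj₁)
inF⇔ (suc n) zero b (suc i) (inside ∷ A) (inside ∷ B) = ⇔-false (¬isVertex-a≡0 ∘ proj₁)
inF⇔ (suc n) (suc a) zero (suc i) (inside ∷ A) (inside ∷ B) = ⇔-false (¬isVertex-b≡0 ∘ proj₁)
inF⇔ (suc n) (suc a) (suc b) (suc i) (inside ∷ A) (inside ∷ B) =
  (isVertex⇔ n a b A B ⇔-∘ isVertex-in-in) ⇔-∘ mk⇔ proj₁ (λ v → v , inj₂ condII-in-in)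

does-inF? : ∀ n a b i (A B : Subset n) → does (inF? n a b i A B) ≡ inFᵇ n a b i A B
does-inF? n a b i A B = does≡ (inF? n a b i A B) (inF⇔ n a b i A B)

-- Binomial identities

pascal : ∀ n k → suc n C suc k ≡ n C k + n C suc k
pascal n k = sym (nCk+nC[k+1]≡[n+1]C[k+1] n k)

nCk*[k!*[n∸k]!]≡n! : ∀ {n k} → k ≤ n → (n C k) * (k ! * (n ∸ k) !) ≡ n !
nCk*[k!*[n∸k]!]≡n! {n} {k} k≤n = trans (cong (_* (k ! * (n ∸ k) !)) (nCk≡n!/k![n-k]! k≤n)) (m/n*n≡m (k![n∸k]!∣n! k≤n))
  where instance _ = k !* (n ∸ k) !≢0

nCk*[k!*r!]≡n! : ∀ {n} k r → k + r ≡ n → (n C k) * (k ! * r !) ≡ n !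
nCk*[k!*r!]≡n! k r refl = subst (λ x → ((k + r) C k) * (k ! * x !) ≡ (k + r) !) (m+n∸m≡n k r) (nCk*[k!*[n∸k]!]≡n! (m≤m+n k r))

C-pos : ∀ {n k} → k ≤ n → 0 < n C k
C-pos {n} {k} k≤n = >-nonZero⁻¹ (n C k) {{m*n≢0⇒m≢0 (n C k) {{subst NonZero (sym (nCk*[k!*[n∸k]!]≡n! k≤n)) (n !≢0)}}}}

C-revision : ∀ c a r → ((c + a + r) C (a + r)) * ((a + r) C a) ≡ ((c + a) C a) * ((c + a + r) C r)
C-revision c a r = *-cancelʳ-≡ _ _ (a ! * (r ! * c !)) {{m*n≢0 _ _ {{a !≢0}} {{r !* c !≢0}}}} (trans lhs (sym rhs))
  where
  open ≡-Reasoning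
  N = c + a + r
  lhs : (N C (a + r)) * ((a + r) C a) * (a ! * (r ! * c !)) ≡ N !
  lhs = begin
    (N C (a + r)) * ((a + r) C a) * (a ! * (r ! * c !))  ≡⟨ regroup (N C (a + r)) ((a + r) C a) (a !) (r !) (c !) ⟩
    (N C (a + r)) * (((a + r) C a) * (a ! * r !) * c !) ≡⟨ cong (λ u → (N C (a + r)) * (u * c !)) (nCk*[k!*r!]≡n! a r refl) ⟩
    (N C (a + r)) * ((a + r) ! * c !)                   ≡⟨ nCk*[k!*r!]≡n! (a + r) c (solve c a r) ⟩
    N !                                                 ∎
    where
    regroup : ∀ u v x y z → u * v * (x * (y * z)) ≡ u * ((v * (x * y)) * z)
    regroup = solve-∀
    solve : ∀ c a r → a + r + c ≡ c + a + r
    solve = solve-∀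
  rhs : ((c + a) C a) * (N C r) * (a ! * (r ! * c !)) ≡ N !
  rhs = begin
    ((c + a) C a) * (N C r) * (a ! * (r ! * c !))  ≡⟨ regroup ((c + a) C a) (N C r) (a !) (r !) (c !) ⟩
    (N C r) * (r ! * (((c + a) C a) * (a ! * c !))) ≡⟨ cong (λ u → (N C r) * (r ! * u)) (nCk*[k!*r!]≡n! a c (+-comm a c)) ⟩
    (N C r) * (r ! * (c + a) !)                     ≡⟨ nCk*[k!*r!]≡n! r (c + a) (solve c a r) ⟩
    N !                                             ∎
    where
    regroup : ∀ u v x y z → u * v * (x * (y * z)) ≡ v * (y * (u * (x * z)))
    regroup = solve-∀
    solve : ∀ c a r → r + (c + a) ≡ c + a + r
    solve = solve-∀

C-shift₂ : ∀ c p → ((2 + c + p) C p) * ((2 + c) * (1 + c)) ≡ ((2 + c + p) C (2 + p)) * ((2 + p) * (1 + p))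
C-shift₂ c p = *-cancelʳ-≡ _ _ (p ! * c !) {{p !* c !≢0}} (trans lhs (sym rhs))
  where
  N = 2 + c + p
  lhs : (N C p) * ((2 + c) * (1 + c)) * (p ! * c !) ≡ N !
  lhs = trans (regroup (N C p) (p !) (c !) c) (nCk*[k!*r!]≡n! p (2 + c) (+-comm p (2 + c)))
    where
    regroup : ∀ u x y c → u * ((2 + c) * (1 + c)) * (x * y) ≡ u * (x * ((2 + c) * ((1 + c) * y)))
    regroup = solve-∀
  rhs : (N C (2 + p)) * ((2 + p) * (1 + p)) * (p ! * c !) ≡ N !
  rhs = trans (regroup (N C (2 + p)) (p !) (c !) p) (nCk*[k!*r!]≡n! (2 + p) c (solve c p))
    where
    regroup : ∀ u x y p → u * ((2 + p) * (1 + p)) * (x * y) ≡ u * (((2 + p) * ((1 + p) * x)) * y)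
    regroup = solve-∀
    solve : ∀ c p → 2 + p + c ≡ 2 + c + p
    solve = solve-∀

C-absorption : ∀ a r → ((a + r) C a) * suc (a + r) ≡ (suc (a + r) C suc a) * suc a
C-absorption a r = *-cancelʳ-≡ _ _ (a ! * r !) {{a !* r !≢0}} (trans lhs (sym rhs))
  where
  lhs : ((a + r) C a) * suc (a + r) * (a ! * r !) ≡ suc (a + r) !
  lhs = trans (regroup ((a + r) C a) (suc (a + r)) (a !) (r !)) (cong (suc (a + r) *_) (nCk*[k!*r!]≡n! a r refl))
    where
    regroup : ∀ u s x y → u * s * (x * y) ≡ s * (u * (x * y))
    regroup = solve-∀
  rhs : (suc (a + r) C suc a) * suc a * (a ! * r !) ≡ suc (a + r) !
  rhs = trans (regroup (suc (a + r) C suc a) (suc a) (a !) (r !)) (nCk*[k!*r!]≡n! (suc a) r refl)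
    where
    regroup : ∀ u s x y → u * s * (x * y) ≡ u * ((s * x) * y)
    regroup = solve-∀

-- The recursion for |𝓕ᵢ|

vertexCount : ∀ n a b → pairCount n (isVertexᵇ n a b) ≡ (n C b) * (b C a)
vertexCount zero    zero    zero    = pairCount-zero _
vertexCount zero    zero    (suc b) = pairCount-zero _
vertexCount zero    (suc a) zero    = pairCount-zero _
vertexCount zero    (suc a) (suc b) = pairCount-zero _
vertexCount (suc n) zero zero
  rewrite pairCount-suc (isVertexᵇ (suc n) 0 0) | pairCount-false {n} = trans (+-identityʳ _) (trans (+-identityʳ _) (vertexCount n 0 0))
vertexCount (suc n) (suc a) zero
  rewrite pairCount-suc (isVertexᵇ (suc n) (suc a) 0) | pairCount-false {n}
  = trans (+-identityʳ _) (trans (+-identityʳ _) (vertexCount n (suc a) 0))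
vertexCount (suc n) zero (suc b)
  rewrite pairCount-suc (isVertexᵇ (suc n) 0 (suc b)) | pairCount-false {n}
        | vertexCount n 0 (suc b) | vertexCount n 0 b | pascal n b = expand (n C b) (n C suc b)
  where
  expand : ∀ p q → (q * 1 + p * 1) + (0 + 0) ≡ (p + q) * 1
  expand = solve-∀
vertexCount (suc n) (suc a) (suc b)
  rewrite pairCount-suc (isVertexᵇ (suc n) (suc a) (suc b)) | pairCount-false {n}
        | vertexCount n (suc a) (suc b) | vertexCount n (suc a) b | vertexCount n a b | pascal n b | pascal b a
  = expand (n C b) (n C suc b) (b C a) (b C suc a)
  where
  expand : ∀ p q r s → (q * (r + s) + p * s) + (0 + p * r) ≡ (p + q) * (r + s)
  expand = solve-∀

pairCount-suc-cong : ∀ {n m} {p : Subset (suc n) → Subset (suc n) → Bool} {q : Subset (suc m) → Subset (suc m) → Bool} →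
  pairCount n (λ A B → p (outside ∷ A) (outside ∷ B)) ≡ pairCount m (λ A B → q (outside ∷ A) (outside ∷ B)) →
  pairCount n (λ A B → p (outside ∷ A) (inside ∷ B))  ≡ pairCount m (λ A B → q (outside ∷ A) (inside ∷ B)) →
  pairCount n (λ A B → p (inside ∷ A) (outside ∷ B))  ≡ pairCount m (λ A B → q (inside ∷ A) (outside ∷ B)) →
  pairCount n (λ A B → p (inside ∷ A) (inside ∷ B))   ≡ pairCount m (λ A B → q (inside ∷ A) (inside ∷ B)) →
  pairCount (suc n) p ≡ pairCount (suc m) q
pairCount-suc-cong oo oi io ii =
  trans (pairCount-suc _) (trans (cong₂ _+_ (cong₂ _+_ oo oi) (cong₂ _+_ io ii)) (sym (pairCount-suc _)))

none≡none : ∀ {n m} → pairCount n (λ _ _ → false) ≡ pairCount m (λ _ _ → false)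
none≡none {n} {m} = trans (pairCount-false {n}) (sym (pairCount-false {m}))

pairCount-inF₀ : ∀ n a b → pairCount (suc n) (inF₀ᵇ (suc n) a b) ≡ pairCount n (isVertexᵇ n a b)
pairCount-inF₀ zero a b rewrite pairCount-suc (inF₀ᵇ 1 a b) | pairCount-false {0} = trans (+-identityʳ _) (+-identityʳ _)
pairCount-inF₀ (suc n) zero zero =
  pairCount-suc-cong (pairCount-inF₀ n 0 0) none≡none none≡none none≡none
pairCount-inF₀ (suc n) (suc a) zero =
  pairCount-suc-cong (pairCount-inF₀ n (suc a) 0) none≡none none≡none none≡none
pairCount-inF₀ (suc n) zero (suc b) =
  pairCount-suc-cong (pairCount-inF₀ n 0 (suc b)) (pairCount-inF₀ n 0 b) none≡none none≡none
pairCount-inF₀ (suc n) (suc a) (suc b) =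
  pairCount-suc-cong (pairCount-inF₀ n (suc a) (suc b)) (pairCount-inF₀ n (suc a) b) none≡none (pairCount-inF₀ n a b)

pairCount-inF-suc : ∀ n a b i → pairCount (suc (suc n)) (inFᵇ (suc (suc n)) (suc a) (suc b) (suc i))
  ≡ pairCount (suc n) (inFᵇ (suc n) (suc a) b i) + pairCount (suc n) (isVertexᵇ (suc n) a b)
pairCount-inF-suc n a b i = trans (pairCount-suc _)
  (cong₂ (λ u v → (u + pairCount (suc n) (inFᵇ (suc n) (suc a) b i)) + (v + pairCount (suc n) (isVertexᵇ (suc n) a b)))
         pairCount-false pairCount-false)

cardF≡pairCount : ∀ n a b i → cardF n a b i ≡ pairCount n (inFᵇ n a b i)
cardF≡pairCount n a b i = trans (cardF≡pairCount-inF? n a b i) (pairCount-cong (does-inF? n a b i))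

cardF-zero : ∀ n a b → cardF (suc n) a b 0 ≡ (n C b) * (b C a)
cardF-zero n a b = trans (cardF≡pairCount (suc n) a b 0) (trans (pairCount-inF₀ n a b) (vertexCount n a b))

cardF-suc : ∀ n a b i → cardF (suc (suc n)) (suc a) (suc b) (suc i) ≡ cardF (suc n) (suc a) b i + (suc n C b) * (b C a)
cardF-suc n a b i = begin
  cardF (suc (suc n)) (suc a) (suc b) (suc i)  ≡⟨ cardF≡pairCount _ _ _ _ ⟩
  pairCount (suc (suc n)) (inFᵇ (suc (suc n)) (suc a) (suc b) (suc i))  ≡⟨ pairCount-inF-suc n a b i ⟩
  pairCount (suc n) (inFᵇ (suc n) (suc a) b i) + pairCount (suc n) (isVertexᵇ (suc n) a b)
    ≡⟨ cong₂ _+_ (sym (cardF≡pairCount _ _ _ _)) (vertexCount (suc n) a b) ⟩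
  cardF (suc n) (suc a) b i + (suc n C b) * (b C a)  ∎
  where open ≡-Reasoning

-- The closed formula

-- n = 1 + I + c + a + e, |A| = 1 + a and b = I + 1 + a + e, so that c = n − b and e = b − |A| − I.
module Telescope (c a e : ℕ) where

  X = c + a + e
  Y = suc (a + e)
  K = (c + a) C a
  g = (X C Y) * (Y C suc a)

  telescope : ∀ I → cardF (suc (I + X)) (suc a) (I + Y) I + K * (suc X C e) ≡ g + K * (suc (I + X) C (I + e))
  telescope zero = cong (λ t → t + K * (suc X C e)) (cardF-zero X (suc a) Y)
  telescope (suc I) = begin
    cardF (suc (suc I + X)) (suc a) (suc I + Y) (suc I) + K * (suc X C e)
      ≡⟨ cong (_+ K * (suc X C e)) (cardF-suc (I + X) a (I + Y) I) ⟩
    cardF (suc (I + X)) (suc a) (I + Y) I + V + K * (suc X C e)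
      ≡⟨ swap (cardF (suc (I + X)) (suc a) (I + Y) I) V (K * (suc X C e)) ⟩
    (cardF (suc (I + X)) (suc a) (I + Y) I + K * (suc X C e)) + V
      ≡⟨ cong₂ _+_ (telescope I) vertices ⟩
    (g + K * (suc (I + X) C (I + e))) + K * (suc (I + X) C suc (I + e))
      ≡⟨ factor g K (suc (I + X) C (I + e)) (suc (I + X) C suc (I + e)) ⟩
    g + K * ((suc (I + X) C (I + e)) + (suc (I + X) C suc (I + e)))
      ≡⟨ cong (λ t → g + K * t) (sym (pascal (suc (I + X)) (I + e))) ⟩
    g + K * (suc (suc I + X) C (suc I + e)) ∎
    where
    open ≡-Reasoning
    V = (suc (I + X) C (I + Y)) * ((I + Y) C a)
    swap : ∀ t v w → t + v + w ≡ (t + w) + v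
    swap = solve-∀
    factor : ∀ g K u v → (g + K * u) + K * v ≡ g + K * (u + v)
    factor = solve-∀
    eqN : ∀ c a e I → c + a + suc (I + e) ≡ suc (I + (c + a + e))
    eqN = solve-∀
    eqB : ∀ a e I → a + suc (I + e) ≡ I + suc (a + e)
    eqB = solve-∀
    vertices : V ≡ K * (suc (I + X) C suc (I + e))
    vertices = subst₂ (λ N B → (N C B) * (B C a) ≡ K * (N C suc (I + e))) (eqN c a e I) (eqB a e I) (C-revision c a (suc (I + e)))

  C-grows : ∀ I → suc X C e ≤ suc (I + X) C (I + e)
  C-grows zero    = ≤-refl
  C-grows (suc I) = ≤-trans (C-grows I) (≤-trans (m≤m+n _ _) (≤-reflexive (sym (pascal (suc (I + X)) (I + e)))))

  closedForm : ∀ I → cardF (suc (I + X)) (suc a) (I + Y) I ≡ g + K * ((suc (I + X) C (I + e)) ∸ (suc X C e))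
  closedForm I = sym (begin
    g + K * (u ∸ w)      ≡⟨ cong (g +_) (*-distribˡ-∸ K u w) ⟩
    g + (K * u ∸ K * w)  ≡⟨ sym (+-∸-assoc g (*-monoʳ-≤ K (C-grows I))) ⟩
    (g + K * u) ∸ K * w  ≡⟨ cong (_∸ K * w) (sym (telescope I)) ⟩
    (f + K * w) ∸ K * w  ≡⟨ m+n∸n≡m f (K * w) ⟩
    f                    ∎)
    where
    open ≡-Reasoning
    u = suc (I + X) C (I + e)
    w = suc X C e
    f = cardF (suc (I + X)) (suc a) (I + Y) I

closedFormula : (n a b i : ℕ) → ℕ
closedFormula n a b i = ((n ∸ 1 ∸ i) C (b ∸ i)) * ((b ∸ i) C a)
  + ((n ∸ b + a ∸ 1) C (a ∸ 1)) * ((n C (b ∸ a)) ∸ ((n ∸ i) C (b ∸ a ∸ i)))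

1+[i+[c+a+e]]∸[i+[1+a+e]]≡c : ∀ c a e i → suc (i + (c + a + e)) ∸ (i + suc (a + e)) ≡ c
1+[i+[c+a+e]]∸[i+[1+a+e]]≡c c a e i = begin
  suc (i + (c + a + e)) ∸ (i + suc (a + e))  ≡⟨ cong (_∸ (i + suc (a + e))) (sym (+-suc i (c + a + e))) ⟩
  i + suc (c + a + e) ∸ (i + suc (a + e))     ≡⟨ [m+n]∸[m+o]≡n∸o i (suc (c + a + e)) (suc (a + e)) ⟩
  c + a + e ∸ (a + e)                         ≡⟨ cong (_∸ (a + e)) (+-assoc c a e) ⟩
  c + (a + e) ∸ (a + e)                       ≡⟨ m+n∸n≡m c (a + e) ⟩
  c                                           ∎
  where open ≡-Reasoning

i+[1+a+e]∸[1+a]≡i+e : ∀ a e i → i + suc (a + e) ∸ suc a ≡ i + e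
i+[1+a+e]∸[1+a]≡i+e a e i = trans (cong (_∸ suc a) (reorder a e i)) (m+n∸m≡n (suc a) (i + e))
  where
  reorder : ∀ a e i → i + suc (a + e) ≡ suc a + (i + e)
  reorder = solve-∀

1+[i+n]∸i≡1+n : ∀ i n → suc (i + n) ∸ i ≡ suc n
1+[i+n]∸i≡1+n i n = trans (cong (_∸ i) (sym (+-suc i n))) (m+n∸m≡n i (suc n))

[i+1+d]∸1∸i≡d : ∀ i d → i + suc d ∸ 1 ∸ i ≡ d
[i+1+d]∸1∸i≡d i d = trans (cong (λ t → t ∸ 1 ∸ i) (+-suc i d)) (m+n∸m≡n i d)

closedFormula-canonical : ∀ c a e i → cardF (suc (i + (c + a + e))) (suc a) (i + suc (a + e)) i
  ≡ closedFormula (suc (i + (c + a + e))) (suc a) (i + suc (a + e)) i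
closedFormula-canonical c a e i
  rewrite m+n∸m≡n i (c + a + e) | m+n∸m≡n i (suc (a + e)) | 1+[i+[c+a+e]]∸[i+[1+a+e]]≡c c a e i | +-suc c a
        | i+[1+a+e]∸[1+a]≡i+e a e i | m+n∸m≡n i e | 1+[i+n]∸i≡1+n i (c + a + e)
  = Telescope.closedForm c a e i

cardF≡closedFormula : ∀ {n a b i} .{{_ : NonZero a}} → b ≤ n → i + a ≤ b → cardF n a b i ≡ closedFormula n a b i
cardF≡closedFormula {n} {suc a} {b} {i} b≤n i+a≤b with m≤n⇒∃[o]m+o≡n i+a≤b
... | e , refl with m≤n⇒∃[o]m+o≡n b≤n
... | c , refl = subst₂ (λ n b → cardF n (suc a) b i ≡ closedFormula n (suc a) b i) (eqN c a e i) (eqB a e i)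
                        (closedFormula-canonical c a e i)
  where
  eqN : ∀ c a e i → suc (i + (c + a + e)) ≡ i + suc a + e + c
  eqN = solve-∀
  eqB : ∀ a e i → i + suc (a + e) ≡ i + suc a + e
  eqB = solve-∀

OrderedLike : ℕ → ℕ → ℕ → ℕ → Set
OrderedLike q X x y = (q < X → x < y) × (q ≡ X → x ≡ y) × (X < q → y < x)

orderedLike-by-ratio : ∀ {q X x y v w} → y + v ≡ x + w → w * q ≡ v * X → 0 < v → 0 < q → OrderedLike q X x y
orderedLike-by-ratio {q@(suc _)} {X} {x} {y} {v@(suc _)} {w} y+v≡x+w w*q≡v*X _ _ = increasing , constant , decreasing
  where
  increasing : q < X → x < y
  increasing q<X = +-cancelʳ-< v x y (<-≤-trans (+-monoʳ-< x v<w) (≤-reflexive (sym y+v≡x+w)))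
    where
    v<w : v < w
    v<w = *-cancelʳ-< q v w (<-≤-trans (*-monoʳ-< v q<X) (≤-reflexive (sym w*q≡v*X)))
  constant : q ≡ X → x ≡ y
  constant q≡X = sym (+-cancelʳ-≡ v y x (trans y+v≡x+w (cong (x +_) (sym v≡w))))
    where
    v≡w : v ≡ w
    v≡w = sym (*-cancelʳ-≡ w v q (trans w*q≡v*X (cong (v *_) (sym q≡X))))
  decreasing : X < q → y < x
  decreasing X<q = +-cancelʳ-< v y x (≤-<-trans (≤-reflexive y+v≡x+w) (+-monoʳ-< x w<v))
    where
    w<v : w < v
    w<v = *-cancelʳ-< q w v (≤-<-trans (≤-reflexive w*q≡v*X) (*-monoʳ-< v X<q))

-- |A| = 1 + a, n − b = c ≥ 2, D = b − 1 − i and R = n − 2 − i. Then f (i + 1) − f i = w − v, and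
-- w / v = |A| D / (c (c − 1)).
module Consecutive (c₂ a e' i : ℕ) where

  c = suc (suc c₂)
  n = suc (i + (c + a + suc e'))
  b = i + suc (a + suc e')
  D = a + suc e'
  R = c + a + e'
  K = (c + a) C a
  Z = K * (n C (i + suc e'))
  u = (R C D) * (D C a)
  y = (R C D) * (D C suc a)
  v = (R C suc D) * (suc D C suc a)
  w = (R C (a + e')) * (D C a)

  [c+a+1+e']≡1+R : c + a + suc e' ≡ suc R
  [c+a+1+e']≡1+R = +-suc (c + a) e'

  D≡1+[a+e'] : D ≡ suc (a + e')
  D≡1+[a+e'] = +-suc a e'

  at-i : cardF n (suc a) b i + K * ((suc R C e') + (suc R C suc e')) ≡ (u + y + v) + Z
  at-i = begin
    cardF n (suc a) b i + K * ((suc R C e') + (suc R C suc e'))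
      ≡⟨ cong (λ t → cardF n (suc a) b i + K * t) (sym (pascal (suc R) e')) ⟩
    cardF n (suc a) b i + K * (suc (suc R) C suc e')
      ≡⟨ cong (λ m → cardF n (suc a) b i + K * (suc m C suc e')) (sym [c+a+1+e']≡1+R) ⟩
    cardF n (suc a) b i + K * (suc (c + a + suc e') C suc e')
      ≡⟨ Telescope.telescope c a (suc e') i ⟩
    ((c + a + suc e') C suc D) * (suc D C suc a) + Z
      ≡⟨ cong (λ m → (m C suc D) * (suc D C suc a) + Z) [c+a+1+e']≡1+R ⟩
    (suc R C suc D) * (suc D C suc a) + Z
      ≡⟨ cong (λ t → t * (suc D C suc a) + Z) (pascal R D) ⟩
    ((R C D) + (R C suc D)) * (suc D C suc a) + Z
      ≡⟨ cong (_+ Z) (*-distribʳ-+ (suc D C suc a) (R C D) (R C suc D)) ⟩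
    (R C D) * (suc D C suc a) + v + Z
      ≡⟨ cong (λ t → (R C D) * t + v + Z) (pascal D a) ⟩
    (R C D) * ((D C a) + (D C suc a)) + v + Z
      ≡⟨ cong (λ t → t + v + Z) (*-distribˡ-+ (R C D) (D C a) (D C suc a)) ⟩
    (u + y + v) + Z ∎
    where open ≡-Reasoning

  at-suc-i : cardF n (suc a) b (suc i) + K * (suc R C e') ≡ y + Z
  at-suc-i = begin
    cardF n (suc a) b (suc i) + K * (suc R C e')
      ≡⟨ cong₂ (λ n' b' → cardF n' (suc a) b' (suc i) + K * (suc R C e')) n≡ b≡ ⟩
    cardF (suc (suc i + R)) (suc a) (suc i + suc (a + e')) (suc i) + K * (suc R C e')
      ≡⟨ Telescope.telescope c a e' (suc i) ⟩
    (R C suc (a + e')) * (suc (a + e') C suc a) + K * (suc (suc i + R) C (suc i + e'))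
      ≡⟨ cong₂ (λ d n' → (R C d) * (d C suc a) + K * (n' C (suc i + e'))) (sym D≡1+[a+e']) (sym n≡) ⟩
    y + K * (n C (suc i + e'))
      ≡⟨ cong (λ k → y + K * (n C k)) (sym (+-suc i e')) ⟩
    y + Z ∎
    where
    open ≡-Reasoning
    n≡ : n ≡ suc (suc i + R)
    n≡ = cong suc (trans (cong (i +_) [c+a+1+e']≡1+R) (+-suc i R))
    b≡ : b ≡ suc i + suc (a + e')
    b≡ = trans (cong (λ d → i + suc d) D≡1+[a+e']) (+-suc i (suc (a + e')))

  vertices-at-i : K * (suc R C suc e') ≡ w + u
  vertices-at-i = begin
    K * (suc R C suc e')                        ≡⟨ cong (λ m → K * (m C suc e')) (sym [c+a+1+e']≡1+R) ⟩
    K * ((c + a + suc e') C suc e')             ≡⟨ sym (C-revision c a (suc e')) ⟩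
    ((c + a + suc e') C D) * (D C a)            ≡⟨ cong₂ (λ m d → (m C d) * (D C a)) [c+a+1+e']≡1+R D≡1+[a+e'] ⟩
    (suc R C suc (a + e')) * (D C a)            ≡⟨ cong (_* (D C a)) (pascal R (a + e')) ⟩
    ((R C (a + e')) + (R C suc (a + e'))) * (D C a) ≡⟨ *-distribʳ-+ (D C a) (R C (a + e')) _ ⟩
    w + (R C suc (a + e')) * (D C a)            ≡⟨ cong (λ d → w + (R C d) * (D C a)) (sym D≡1+[a+e']) ⟩
    w + u ∎
    where open ≡-Reasoning

  consecutive : cardF n (suc a) b (suc i) + v ≡ cardF n (suc a) b i + w
  consecutive = +-cancelʳ-≡ (K * (suc R C e') + u) _ _ (begin
    f₁ + v + (K * (suc R C e') + u)              ≡⟨ regroup f₁ v (K * (suc R C e')) u ⟩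
    (f₁ + K * (suc R C e')) + u + v              ≡⟨ cong (λ t → t + u + v) at-suc-i ⟩
    (y + Z) + u + v                              ≡⟨ regroup′ y Z u v ⟩
    (u + y + v) + Z                              ≡⟨ sym at-i ⟩
    f₀ + K * ((suc R C e') + (suc R C suc e'))   ≡⟨ cong (f₀ +_) (*-distribˡ-+ K (suc R C e') _) ⟩
    f₀ + (K * (suc R C e') + K * (suc R C suc e')) ≡⟨ cong (λ t → f₀ + (K * (suc R C e') + t)) vertices-at-i ⟩
    f₀ + (K * (suc R C e') + (w + u))            ≡⟨ regroup″ f₀ (K * (suc R C e')) w u ⟩
    f₀ + w + (K * (suc R C e') + u)              ∎)
    where
    open ≡-Reasoning
    f₀ = cardF n (suc a) b i
    f₁ = cardF n (suc a) b (suc i)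
    regroup : ∀ f v k u → f + v + (k + u) ≡ (f + k) + u + v
    regroup = solve-∀
    regroup′ : ∀ y Z u v → (y + Z) + u + v ≡ (u + y + v) + Z
    regroup′ = solve-∀
    regroup″ : ∀ f k w u → f + (k + (w + u)) ≡ f + w + (k + u)
    regroup″ = solve-∀

  ratio : w * (c * suc c₂) ≡ v * (suc a * D)
  ratio = *-cancelʳ-≡ _ _ (suc D) (begin
    w * (c * suc c₂) * suc D                                      ≡⟨ regroup (R C (a + e')) (D C a) (c * suc c₂) (suc D) ⟩
    ((R C (a + e')) * (c * suc c₂)) * ((D C a) * suc D)           ≡⟨ cong₂ _*_ shift absorb ⟩
    ((R C suc D) * (suc D * D)) * ((suc D C suc a) * suc a)       ≡⟨ regroup′ (R C suc D) (suc D) D (suc D C suc a) (suc a) ⟩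
    v * (suc a * D) * suc D                                       ∎)
    where
    open ≡-Reasoning
    regroup : ∀ x y q s → x * y * q * s ≡ (x * q) * (y * s)
    regroup = solve-∀
    regroup′ : ∀ x s d y t → (x * (s * d)) * (y * t) ≡ x * y * (t * d) * s
    regroup′ = solve-∀
    R≡ : R ≡ 2 + c₂ + (a + e')
    R≡ = +-assoc c a e'
    shift : (R C (a + e')) * (c * suc c₂) ≡ (R C suc D) * (suc D * D)
    shift = subst₂ (λ N d → (N C (a + e')) * (c * suc c₂) ≡ (N C suc d) * (suc d * d)) (sym R≡) (sym D≡1+[a+e'])
                   (C-shift₂ c₂ (a + e'))
    absorb : (D C a) * suc D ≡ (suc D C suc a) * suc a
    absorb = C-absorption a (suc e')

  v-pos : 0 < v
  v-pos = *-mono-< (C-pos 1+D≤R) (C-pos (s≤s (m≤m+n a (suc e'))))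
    where
    1+D≤R : suc D ≤ R
    1+D≤R = subst (suc D ≤_) (R≡ c₂ a e') (m≤m+n (suc D) c₂)
      where
      R≡ : ∀ c₂ a e' → suc (a + suc e') + c₂ ≡ suc (suc c₂) + a + e'
      R≡ = solve-∀

  orderedLike : OrderedLike ((n ∸ b) * (n ∸ b ∸ 1)) (suc a * (b ∸ 1 ∸ i)) (cardF n (suc a) b i) (cardF n (suc a) b (suc i))
  orderedLike rewrite 1+[i+[c+a+e]]∸[i+[1+a+e]]≡c c a (suc e') i | [i+1+d]∸1∸i≡d i D =
    orderedLike-by-ratio consecutive ratio v-pos (s≤s z≤n)

cardF-step : ∀ {n a b i} .{{_ : NonZero a}} → 2 + b ≤ n → suc i + a ≤ b →
  OrderedLike ((n ∸ b) * (n ∸ b ∸ 1)) (a * (b ∸ 1 ∸ i)) (cardF n a b i) (cardF n a b (suc i))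
cardF-step {n} {suc a} {b} {i} 2+b≤n 1+i+a≤b with m≤n⇒∃[o]m+o≡n 1+i+a≤b
... | e' , refl with m≤n⇒∃[o]m+o≡n 2+b≤n
... | c₂ , refl = subst₂ (λ n b → OrderedLike ((n ∸ b) * (n ∸ b ∸ 1)) (suc a * (b ∸ 1 ∸ i))
                                             (cardF n (suc a) b i) (cardF n (suc a) b (suc i)))
                         (eqN c₂ a e' i) (eqB a e' i) (Consecutive.orderedLike c₂ a e' i)
  where
  eqN : ∀ c₂ a e' i → suc (i + (suc (suc c₂) + a + suc e')) ≡ 2 + (suc i + suc a + e') + c₂
  eqN = solve-∀
  eqB : ∀ a e' i → i + suc (a + suc e') ≡ suc i + suc a + e'
  eqB = solve-∀

-- Unimodal sequences

module _ (f : ℕ → ℕ) where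

  rising-to : ∀ p → (∀ i → i < p → f i < f (suc i)) → ∀ j → j < p → f j < f p
  rising-to (suc p) rises j j<1+p with m<1+n⇒m<n∨m≡n j<1+p
  ... | inj₁ j<p  = <-trans (rising-to p (λ i i<p → rises i (m<n⇒m<1+n i<p)) j j<p) (rises p ≤-refl)
  ... | inj₂ refl = rises j ≤-refl

  falling-from : ∀ p M → (∀ i → p ≤ i → i < M → f (suc i) < f i) → ∀ j → p < j → j ≤ M → f j < f p
  falling-from p M falls (suc j) p<1+j 1+j≤M with m<1+n⇒m<n∨m≡n p<1+j
  ... | inj₁ p<j  = <-trans (falls j (<⇒≤ p<j) 1+j≤M) (falling-from p M falls j p<j (<⇒≤ 1+j≤M))
  ... | inj₂ refl = falls j ≤-refl 1+j≤M

module Unimodal (f : ℕ → ℕ) (a q T m : ℕ) .{{_ : NonZero a}} (0<q : 0 < q) (X[m]≤q : a * (T ∸ m) ≤ q)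
                (step : ∀ i → i ≤ m → OrderedLike q (a * (T ∸ i)) (f i) (f (suc i))) where

  -- a (T ∸ i) > q for i < i₀ and a (T ∸ i) ≤ q for i ≥ i₀; when a ∣ q and q ≤ a T, equality holds at i₀.
  t = q / a
  i₀ = T ∸ t

  <m+1⇒≤m : ∀ {i} → i < m + 1 → i ≤ m
  <m+1⇒≤m {i} i<m+1 = m<1+n⇒m≤n (subst (i <_) (+-comm m 1) i<m+1)

  rises : ∀ i → i ≤ m → q < a * (T ∸ i) → f i < f (suc i)
  rises i i≤m = proj₁ (step i i≤m)

  falls : ∀ i → i ≤ m → a * (T ∸ i) < q → f (suc i) < f i
  falls i i≤m = proj₂ (proj₂ (step i i≤m))

  t*a≤q : t * a ≤ q
  t*a≤q = m/n*n≤m q a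

  q<[1+t]*a : q < suc t * a
  q<[1+t]*a = subst (_< suc t * a) (sym (m≡m%n+[m/n]*n q a)) (+-monoˡ-< (t * a) (m%n<n q a))

  a*x≤q⇒x≤t : ∀ {x} → a * x ≤ q → x ≤ t
  a*x≤q⇒x≤t {x} a*x≤q = m<1+n⇒m≤n (*-cancelʳ-< a x (suc t) (≤-<-trans (≤-reflexive (*-comm x a)) (≤-<-trans a*x≤q q<[1+t]*a)))

  x≤t⇒a*x≤q : ∀ {x} → x ≤ t → a * x ≤ q
  x≤t⇒a*x≤q {x} x≤t = ≤-trans (*-monoʳ-≤ a x≤t) (≤-trans (≤-reflexive (*-comm a t)) t*a≤q)

  x<t⇒a*x<q : ∀ {x} → x < t → a * x < q
  x<t⇒a*x<q {x} x<t = <-≤-trans (*-monoʳ-< a x<t) (≤-trans (≤-reflexive (*-comm a t)) t*a≤q)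

  t<x⇒q<a*x : ∀ {x} → t < x → q < a * x
  t<x⇒q<a*x {x} t<x = <-≤-trans q<[1+t]*a (≤-trans (*-monoˡ-≤ a t<x) (≤-reflexive (*-comm x a)))

  i₀≤m : i₀ ≤ m
  i₀≤m = m≤n+o⇒m∸n≤o T t
    (≤-trans (m≤n+m∸n T m) (≤-trans (+-monoʳ-≤ m (a*x≤q⇒x≤t X[m]≤q)) (≤-reflexive (+-comm m t))))

  i<i₀⇒t<T∸i : ∀ {i} → i < i₀ → t < T ∸ i
  i<i₀⇒t<T∸i {i} i<i₀ = m+n≤o⇒m≤o∸n (suc t) (subst (_≤ T) (cong suc (+-comm i t)) (m≤o∸n⇒m+n≤o (suc i) t≤T i<i₀))
    where
    t≤T : t ≤ T
    t≤T = <⇒≤ (m∸n≢0⇒n<m λ T∸t≡0 → contradiction (subst (i <_) T∸t≡0 i<i₀) λ ())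

  i₀≤i⇒T∸i≤t : ∀ {i} → i₀ ≤ i → T ∸ i ≤ t
  i₀≤i⇒T∸i≤t {i} i₀≤i = m≤n+o⇒m∸n≤o T i
    (≤-trans (m≤n+m∸n T t) (≤-trans (+-monoʳ-≤ t i₀≤i) (≤-reflexive (+-comm t i))))

  i₀<i⇒T∸i<t : ∀ {i} → .{{NonZero t}} → i₀ < i → T ∸ i < t
  i₀<i⇒T∸i<t {i} i₀<i = m<n+o⇒m∸n<o T i
    (≤-<-trans (m≤n+m∸n T t) (<-≤-trans (+-monoʳ-< t i₀<i) (≤-reflexive (+-comm t i))))

  rises-before-i₀ : ∀ i → i < i₀ → f i < f (suc i)
  rises-before-i₀ i i<i₀ = rises i (≤-trans (<⇒≤ i<i₀) i₀≤m) (t<x⇒q<a*x (i<i₀⇒t<T∸i i<i₀))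

  max-at-0 : a * T < q → ∀ j → j ≤ m + 1 → j ≢ 0 → f j < f 0
  max-at-0 a*T<q zero _ 0≢0 = contradiction refl 0≢0
  max-at-0 a*T<q (suc j) 1+j≤m+1 _ = falling-from f 0 (m + 1) falls-everywhere (suc j) (s≤s z≤n) 1+j≤m+1
    where
    falls-everywhere : ∀ i → 0 ≤ i → i < m + 1 → f (suc i) < f i
    falls-everywhere i _ i<m+1 = falls i (<m+1⇒≤m i<m+1) (≤-<-trans (*-monoʳ-≤ a (m∸n≤m T i)) a*T<q)

  max-at-i₀-and-next : q ≤ a * T → a ∣ q → suc i₀ ≤ m + 1 × f i₀ ≡ f (suc i₀)
    × (∀ j → j ≤ m + 1 → j ≢ i₀ → j ≢ suc i₀ → f j < f i₀)
  max-at-i₀-and-next q≤a*T a∣q = subst (suc i₀ ≤_) (+-comm 1 m) (s≤s i₀≤m) , plateau , others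
    where
    t*a≡q : t * a ≡ q
    t*a≡q = m/n*n≡m a∣q
    instance
      t≢0 : NonZero t
      t≢0 = >-nonZero (m<n*o⇒0<n t*a≡q)
        where
        m<n*o⇒0<n : ∀ {u} → u * a ≡ q → 0 < u
        m<n*o⇒0<n {zero} 0≡q = contradiction (sym 0≡q) (>⇒≢ 0<q)
        m<n*o⇒0<n {suc u} _ = s≤s z≤n
    t≤T : t ≤ T
    t≤T = *-cancelʳ-≤ t T a (≤-trans t*a≤q (≤-trans q≤a*T (≤-reflexive (*-comm a T))))
    plateau : f i₀ ≡ f (suc i₀)
    plateau = proj₁ (proj₂ (step i₀ i₀≤m)) (trans (sym t*a≡q) (trans (*-comm t a) (cong (a *_) (sym (m∸[m∸n]≡n t≤T)))))
    falls-after : ∀ i → suc i₀ ≤ i → i < m + 1 → f (suc i) < f i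
    falls-after i i₀<i i<m+1 = falls i (<m+1⇒≤m i<m+1) (x<t⇒a*x<q (i₀<i⇒T∸i<t i₀<i))
    others : ∀ j → j ≤ m + 1 → j ≢ i₀ → j ≢ suc i₀ → f j < f i₀
    others j j≤m+1 j≢i₀ j≢1+i₀ with <-cmp j i₀
    ... | tri< j<i₀ _ _ = rising-to f i₀ rises-before-i₀ j j<i₀
    ... | tri≈ _ j≡i₀ _ = contradiction j≡i₀ j≢i₀
    ... | tri> _ _ i₀<j with m≤n⇒m<n∨m≡n i₀<j
    ...   | inj₂ 1+i₀≡j = contradiction (sym 1+i₀≡j) j≢1+i₀
    ...   | inj₁ 1+i₀<j = subst (f j <_) (sym plateau) (falling-from f (suc i₀) (m + 1) falls-after j 1+i₀<j j≤m+1)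

  max-at-i₀ : ¬ a ∣ q → i₀ ≤ m + 1 × (∀ j → j ≤ m + 1 → j ≢ i₀ → f j < f i₀)
  max-at-i₀ a∤q = ≤-trans i₀≤m (m≤m+n m 1) , others
    where
    falls-from-i₀ : ∀ i → i₀ ≤ i → i < m + 1 → f (suc i) < f i
    falls-from-i₀ i i₀≤i i<m+1 = falls i (<m+1⇒≤m i<m+1) (≤∧≢⇒< (x≤t⇒a*x≤q (i₀≤i⇒T∸i≤t i₀≤i)) X≢q)
      where
      X≢q : a * (T ∸ i) ≢ q
      X≢q X≡q = a∤q (divides (T ∸ i) (trans (sym X≡q) (*-comm a (T ∸ i))))
    others : ∀ j → j ≤ m + 1 → j ≢ i₀ → f j < f i₀
    others j j≤m+1 j≢i₀ with <-cmp j i₀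
    ... | tri< j<i₀ _ _ = rising-to f i₀ rises-before-i₀ j j<i₀
    ... | tri≈ _ j≡i₀ _ = contradiction j≡i₀ j≢i₀
    ... | tri> _ _ i₀<j = falling-from f i₀ (m + 1) falls-from-i₀ j i₀<j j≤m+1

module SideConditions (a b c : ℕ) .{{_ : NonZero a}} (a<c : a < c) (c<b : c < b) where

  private
    n = b + c
    m = 2 * b ∸ n

  m+c≡b : m + c ≡ b
  m+c≡b = trans (cong (_+ c) (trans ([m+n]∸[m+o]≡n∸o b (b + 0) c) (cong (_∸ c) (+-identityʳ b)))) (m∸n+n≡m (<⇒≤ c<b))

  i+a≤b : ∀ i → i ≤ m + 1 → i + a ≤ b
  i+a≤b i i≤m+1 = begin
    i + a      ≤⟨ +-monoˡ-≤ a i≤m+1 ⟩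
    m + 1 + a  ≡⟨ +-assoc m 1 a ⟩
    m + suc a  ≤⟨ +-monoʳ-≤ m a<c ⟩
    m + c      ≡⟨ m+c≡b ⟩
    b          ∎
    where open ≤-Reasoning

  1+i+a≤b : ∀ i → i ≤ m → suc i + a ≤ b
  1+i+a≤b i i≤m = i+a≤b (suc i) (subst (suc i ≤_) (+-comm 1 m) (s≤s i≤m))

  2≤c : 2 ≤ c
  2≤c = ≤-trans (s≤s (>-nonZero⁻¹ a)) a<c

  2+b≤n : 2 + b ≤ n
  2+b≤n = subst (_≤ n) (+-comm b 2) (+-monoʳ-≤ b 2≤c)

  n∸b≡c : n ∸ b ≡ c
  n∸b≡c = m+n∸m≡n b c

  0<q : 0 < (n ∸ b) * (n ∸ b ∸ 1)
  0<q rewrite n∸b≡c = *-mono-< (≤-trans (s≤s z≤n) 2≤c) (∸-monoˡ-< 2≤c (s≤s z≤n))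

  X[m]≤q : a * (b ∸ 1 ∸ m) ≤ (n ∸ b) * (n ∸ b ∸ 1)
  X[m]≤q rewrite n∸b≡c = ≤-trans (≤-reflexive (cong (a *_) b∸1∸m≡c∸1)) (*-monoˡ-≤ (c ∸ 1) (<⇒≤ a<c))
    where
    open ≡-Reasoning
    b∸1∸m≡c∸1 : b ∸ 1 ∸ m ≡ c ∸ 1
    b∸1∸m≡c∸1 = begin
      b ∸ 1 ∸ m        ≡⟨ ∸-+-assoc b 1 m ⟩
      b ∸ (1 + m)      ≡⟨ cong₂ _∸_ (sym m+c≡b) (+-comm 1 m) ⟩
      m + c ∸ (m + 1)  ≡⟨ [m+n]∸[m+o]≡n∸o m c 1 ⟩
      c ∸ 1            ∎

mainTheorem7 : (n a b : ℕ) → .{{_ : NonZero a}} → a + b < n → n < 2 * b →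
    ((i : ℕ) → i ≤ 2 * b ∸ n + 1 →
      cardF n a b i ≡ ((n ∸ 1 ∸ i) C (b ∸ i)) * ((b ∸ i) C a)
        + ((n ∸ b + a ∸ 1) C (a ∸ 1)) * ((n C (b ∸ a)) ∸ ((n ∸ i) C (b ∸ a ∸ i))))
    × (a * (b ∸ 1) < (n ∸ b) * (n ∸ b ∸ 1) →
      (j : ℕ) → j ≤ 2 * b ∸ n + 1 → j ≢ 0 → cardF n a b j < cardF n a b 0)
    × ((n ∸ b) * (n ∸ b ∸ 1) ≤ a * (b ∸ 1) → a ∣ (n ∸ b) * (n ∸ b ∸ 1) →
      suc (b ∸ 1 ∸ (n ∸ b) * (n ∸ b ∸ 1) / a) ≤ 2 * b ∸ n + 1
      × cardF n a b (b ∸ 1 ∸ (n ∸ b) * (n ∸ b ∸ 1) / a)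
        ≡ cardF n a b (suc (b ∸ 1 ∸ (n ∸ b) * (n ∸ b ∸ 1) / a))
      × ((j : ℕ) → j ≤ 2 * b ∸ n + 1 → j ≢ b ∸ 1 ∸ (n ∸ b) * (n ∸ b ∸ 1) / a →
        j ≢ suc (b ∸ 1 ∸ (n ∸ b) * (n ∸ b ∸ 1) / a) →
        cardF n a b j < cardF n a b (b ∸ 1 ∸ (n ∸ b) * (n ∸ b ∸ 1) / a)))
    × ((n ∸ b) * (n ∸ b ∸ 1) ≤ a * (b ∸ 1) → ¬ (a ∣ (n ∸ b) * (n ∸ b ∸ 1)) →
      b ∸ 1 ∸ (n ∸ b) * (n ∸ b ∸ 1) / a ≤ 2 * b ∸ n + 1
      × ((j : ℕ) → j ≤ 2 * b ∸ n + 1 → j ≢ b ∸ 1 ∸ (n ∸ b) * (n ∸ b ∸ 1) / a →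
        cardF n a b j < cardF n a b (b ∸ 1 ∸ (n ∸ b) * (n ∸ b ∸ 1) / a)))
-- The last part holds without its first hypothesis (n ∸ b) * (n ∸ b ∸ 1) ≤ a * (b ∸ 1).
mainTheorem7 n a b a+b<n n<2b with m≤n⇒∃[o]m+o≡n (≤-trans (m≤n+m b a) (<⇒≤ a+b<n))
... | c , refl =
  (λ i i≤m+1 → cardF≡closedFormula (m≤m+n b c) (i+a≤b i i≤m+1)) , max-at-0 , max-at-i₀-and-next , λ _ → max-at-i₀
  where
  a<c : a < c
  a<c = +-cancelʳ-< b a c (subst (a + b <_) (+-comm b c) a+b<n)
  c<b : c < b
  c<b = +-cancelˡ-< b c b (subst (b + c <_) (cong (b +_) (+-identityʳ b)) n<2b)
  open SideConditions a b c a<c c<b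
  open Unimodal (cardF n a b) a ((n ∸ b) * (n ∸ b ∸ 1)) (b ∸ 1) (2 * b ∸ n) 0<q X[m]≤q
    (λ i i≤m → cardF-step 2+b≤n (1+i+a≤b i i≤m))
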